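{- Let $A_1,A_2\subseteq\mathbb{N}$ be non-empty and eventually periodic, and let $\mathfrak m_i=\mathfrak m(A_i)$, $\mathfrak q_i=\mathfrak q(A_i)$ for $i=1,2$. Then: (1) $\mathfrak m(A_1\cup A_2)=\min(\mathfrak m_1,\mathfrak m_2)$ and $\mathfrak q(A_1\cup A_2)=\gcd(\mathfrak q_1,\mathfrak q_2,\mathfrak m_2-\mathfrak m_1)$; (2) $\mathfrak m(A_1+A_2)=\mathfrak m_1+\mathfrak m_2$ and $\mathfrak q(A_1+A_2)=\gcd(\mathfrak q_1,\mathfrak q_2)$; (3) $\mathfrak m(A_1\star A_2)=\mathfrak m_1\mathfrak m_2$, and $\mathfrak q(A_1\star A_2)=0$ if $A_1=\{0\}$, while $\mathfrak q(A_1\star A_2)=\gcd(\mathfrak q_2,\mathfrak q_1\mathfrak m_2)$ if $A_1\neq\{0\}$.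
   Context: $\mathbb{N}=\{0,1,2,\dots\}$. $A\subseteq\mathbb{N}$ is eventually periodic if there are a positive integer $p$ and an $m$ such that $a\in A$, $a\ge m$ imply $a+p\in A$. For $A,B\subseteq\mathbb N$: $A+B=\{a+b:a\in A,b\in B\}$; $n\star B=\{0\}$ if $n=0$ and $n\star B=B+\cdots+B$ ($n$ copies) for $n\ge1$; $A\star B=\bigcup_{a\in A}a\star B$. For non-empty $A$: $\mathfrak m(A)=\min A$, $A-n=\{a-n:a\in A\}$, and $\mathfrak q(A)=\gcd(A-\mathfrak m(A))$, with the convention $\gcd(\{0\})=0$ (gcd of a set of integers). -}

module Defs where

open import Level using (0ℓ)
open import Data.Nat using (ℕ; zero; suc; _+_; _*_; _≤_; _<_)
open import Data.Nat.Divisibility using (_∣_)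
open import Data.Product using (Σ; ∃; _×_; _,_)
open import Data.Sum using (_⊎_)
open import Relation.Binary.PropositionalEquality using (_≡_)
open import Relation.Unary using (Pred)

SetN : Set₁
SetN = Pred ℕ 0ℓ

NonEmpty : SetN → Set
NonEmpty A = ∃ λ a → A a

EventuallyPeriodic : SetN → Set
EventuallyPeriodic A =
  Σ ℕ λ p → (0 < p) × (Σ ℕ λ m → ∀ a → A a → m ≤ a → A (a + p))

_∪ₙ_ : SetN → SetN → SetN
(A ∪ₙ B) x = A x ⊎ B x

_⊕_ : SetN → SetN → SetN
(A ⊕ B) x = Σ ℕ λ a → Σ ℕ λ b → A a × B b × (x ≡ a + b)

_·⋆_ : ℕ → SetN → SetN
(zero ·⋆ B) x = x ≡ 0
(suc n ·⋆ B) x = (B ⊕ (n ·⋆ B)) x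

_⋆_ : SetN → SetN → SetN
(A ⋆ B) x = Σ ℕ λ a → A a × (a ·⋆ B) x

-- A - n = {a - n : a ∈ A}, used only for n ≤ min A, so x ∈ A - n ⟺ x + n ∈ A
_─_ : SetN → ℕ → SetN
(A ─ n) x = A (x + n)

IsMin : SetN → ℕ → Set
IsMin A m = A m × (∀ a → A a → m ≤ a)

-- d is the gcd of the set S: d divides every element, and every common
-- divisor of S divides d (gives gcd {0} = 0, and is unique in ℕ)
IsGcdSet : SetN → ℕ → Set
IsGcdSet S d = (∀ x → S x → d ∣ x) × (∀ c → (∀ x → S x → c ∣ x) → c ∣ d)

IsQ : SetN → ℕ → ℕ → Set
IsQ A m q = IsGcdSet (A ─ m) q

IsZeroSet : SetN → Set
IsZeroSet A = ∀ x → (A x → x ≡ 0) × (x ≡ 0 → A x)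

-- Shifting a set by its minimum turns each operation into one on sets containing 0,
-- where gcds are easy: (A₁ ∪ A₂) − m₁ is (A₁ − m₁) ∪ ((A₂ − m₂) + (m₂ − m₁)) when m₁ ≤ m₂,
-- (A₁ + A₂) − (m₁ + m₂) is (A₁ − m₁) + (A₂ − m₂), and an element of (A₁ ⋆ A₂) − m₁m₂
-- has the form y₁m₂ + y with y₁ ∈ A₁ − m₁ and y a sum of elements of A₂ − m₂.
module Submission where

open import Defs
open import Data.Nat using (ℕ; zero; suc; _+_; _*_; _∸_; _⊓_; ∣_-_∣; _≤_; z≤n; NonZero; _/_; ≢-nonZero)
open import Data.Nat.Properties
open import Data.Nat.Divisibility
open import Data.Nat.DivMod using (m/n*n≡m)
open import Data.Nat.GCD
open import Data.Nat.Coprimality using (coprime-/gcd; coprime-divisor)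
open import Data.Product using (Σ; ∃; _×_; _,_; proj₁; proj₂)
open import Data.Sum using (_⊎_; inj₁; inj₂)
open import Relation.Nullary using (¬_; contradiction)
open import Relation.Nullary.Decidable using (decidable-stable)
open import Relation.Unary using (_⊆_; _≐_)
open import Relation.Unary.Properties using (≐-sym; ≐-trans)
open import Relation.Binary.PropositionalEquality

open import Algebra.Properties.CommutativeSemigroup +-commutativeSemigroup using (interchange; x∙yz≈yx∙z)

variable
  A B S T U : SetN
  a c d e m m₁ m₂ q q₁ q₂ : ℕ

IsGcdSet-resp-≐ : S ≐ T → IsGcdSet S d → IsGcdSet T d
IsGcdSet-resp-≐ (S⊆T , T⊆S) (d∣S , greatest) =
  (λ x Tx → d∣S x (T⊆S Tx)) , (λ c c∣T → greatest c (λ x Sx → c∣T x (S⊆T Sx)))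

IsGcdSet-∪ : IsGcdSet S d → IsGcdSet T e → IsGcdSet (S ∪ₙ T) (gcd d e)
IsGcdSet-∪ {d = d} {e = e} (d∣S , greatestˢ) (e∣T , greatestᵗ) =
  (λ { x (inj₁ Sx) → ∣-trans (gcd[m,n]∣m d e) (d∣S x Sx)
     ; x (inj₂ Tx) → ∣-trans (gcd[m,n]∣n d e) (e∣T x Tx) }) ,
  (λ c c∣S∪T → gcd-greatest (greatestˢ c (λ x Sx → c∣S∪T x (inj₁ Sx)))
                            (greatestᵗ c (λ x Tx → c∣S∪T x (inj₂ Tx))))

IsGcdSet-⊕ : S 0 → T 0 → IsGcdSet S d → IsGcdSet T e → IsGcdSet (S ⊕ T) (gcd d e)
IsGcdSet-⊕ {d = d} {e = e} S0 T0 (d∣S , greatestˢ) (e∣T , greatestᵗ) =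
  (λ { x (s , t , Ss , Tt , refl) →
         ∣m∣n⇒∣m+n (∣-trans (gcd[m,n]∣m d e) (d∣S s Ss)) (∣-trans (gcd[m,n]∣n d e) (e∣T t Tt)) }) ,
  (λ c c∣S⊕T → gcd-greatest
     (greatestˢ c (λ s Ss → c∣S⊕T s (s , 0 , Ss , T0 , sym (+-identityʳ s))))
     (greatestᵗ c (λ t Tt → c∣S⊕T t (0 , t , S0 , Tt , refl))))

IsGcdSet-translate : T 0 → IsGcdSet T d → IsGcdSet (T ⊕ (_≡ e)) (gcd d e)
IsGcdSet-translate {d = d} {e = e} T0 (d∣T , greatest) =
  (λ { x (t , _ , Tt , refl , refl) →
         ∣m∣n⇒∣m+n (∣-trans (gcd[m,n]∣m d e) (d∣T t Tt)) (gcd[m,n]∣n d e) }) ,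
  (λ c c∣T+e → let c∣e = c∣T+e e (0 , e , T0 , refl , refl) in
     gcd-greatest (greatest c (λ t Tt → ∣m+n∣m⇒∣n (c∣T+e (e + t) (t , e , Tt , refl , +-comm e t)) c∣e)) c∣e)

-- Write c = c′ g and m = m′ g with g = gcd c m; since c′ and m′ are coprime, c′ divides
-- every element of S, hence q, and so c = c′ g divides q m.
IsGcdSet-greatest-* : IsGcdSet S q → (∀ x → S x → c ∣ x * m) → c ∣ q * m
IsGcdSet-greatest-* {q = q} {c = c} {m = zero} _ _ = subst (c ∣_) (sym (*-zeroʳ q)) (c ∣0)
IsGcdSet-greatest-* {S = S} {q = q} {c = c} {m = m@(suc _)} (_ , greatest) c∣S*m =
  ∣-trans (subst (_∣ q * g) (sym c≡c′*g) (*-monoˡ-∣ g c′∣q)) (*-monoʳ-∣ q (gcd[m,n]∣n c m))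
  where
  g = gcd c m
  instance
    g≢0 : NonZero g
    g≢0 = ≢-nonZero (gcd[m,n]≢0 c m (inj₂ λ ()))
  c′ = c / g
  m′ = m / g
  c≡c′*g : c ≡ c′ * g
  c≡c′*g = sym (m/n*n≡m (gcd[m,n]∣m c m))
  m≡m′*g : m ≡ m′ * g
  m≡m′*g = sym (m/n*n≡m (gcd[m,n]∣n c m))
  c′∣S : ∀ x → S x → c′ ∣ x
  c′∣S x Sx = coprime-divisor (coprime-/gcd c m) (subst (c′ ∣_) (*-comm x m′)
    (*-cancelʳ-∣ g (subst₂ _∣_ c≡c′*g (trans (cong (x *_) m≡m′*g) (sym (*-assoc x m′ g)))
                                     (c∣S*m x Sx))))
  c′∣q : c′ ∣ q
  c′∣q = greatest c′ c′∣S

IsMin-split : IsMin A m → A a → Σ ℕ λ y → (A ─ m) y × a ≡ y + m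
IsMin-split {A = A} {m = m} {a = a} (_ , least) Aa = a ∸ m , subst A (sym a∸m+m≡a) Aa , sym a∸m+m≡a
  where
  a∸m+m≡a : a ∸ m + m ≡ a
  a∸m+m≡a = m∸n+n≡m (least a Aa)

∪-min : IsMin A m₁ → IsMin B m₂ → IsMin (A ∪ₙ B) (m₁ ⊓ m₂)
∪-min {A = A} {m₁ = m₁} {B = B} {m₂ = m₂} (Am₁ , leastᴬ) (Bm₂ , leastᴮ) = member (⊓-sel m₁ m₂) ,
  λ { x (inj₁ Ax) → ≤-trans (m⊓n≤m m₁ m₂) (leastᴬ x Ax)
    ; x (inj₂ Bx) → ≤-trans (m⊓n≤n m₁ m₂) (leastᴮ x Bx) }
  where
  member : m₁ ⊓ m₂ ≡ m₁ ⊎ m₁ ⊓ m₂ ≡ m₂ → (A ∪ₙ B) (m₁ ⊓ m₂)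
  member (inj₁ eq) = inj₁ (subst A (sym eq) Am₁)
  member (inj₂ eq) = inj₂ (subst B (sym eq) Bm₂)

⊕-min : IsMin A m₁ → IsMin B m₂ → IsMin (A ⊕ B) (m₁ + m₂)
⊕-min {m₁ = m₁} {m₂ = m₂} (Am₁ , leastᴬ) (Bm₂ , leastᴮ) =
  (m₁ , m₂ , Am₁ , Bm₂ , refl) ,
  λ { x (a , b , Aa , Bb , refl) → +-mono-≤ (leastᴬ a Aa) (leastᴮ b Bb) }

·⋆-min : IsMin A m → ∀ n → IsMin (n ·⋆ A) (n * m)
·⋆-min _     zero    = refl , λ { x refl → z≤n }
·⋆-min A-min (suc n) = ⊕-min A-min (·⋆-min A-min n)

⋆-min : IsMin A m₁ → IsMin B m₂ → IsMin (A ⋆ B) (m₁ * m₂)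
⋆-min {m₁ = m₁} {m₂ = m₂} (Am₁ , leastᴬ) B-min =
  (m₁ , Am₁ , proj₁ (·⋆-min B-min m₁)) ,
  λ { x (a , Aa , x∈aB) → ≤-trans (*-monoˡ-≤ m₂ (leastᴬ a Aa)) (proj₂ (·⋆-min B-min a) x x∈aB) }

─-cong : S ≐ T → (S ─ m) ≐ (T ─ m)
─-cong (S⊆T , T⊆S) = S⊆T , T⊆S

⊕-congˡ : T ≐ U → (S ⊕ T) ≐ (S ⊕ U)
⊕-congˡ (T⊆U , U⊆T) =
  (λ (s , t , Ss , Tt , eq) → s , t , Ss , T⊆U Tt , eq) ,
  (λ (s , u , Ss , Uu , eq) → s , u , Ss , U⊆T Uu , eq)

∪-comm : (S ∪ₙ T) ≐ (T ∪ₙ S)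
∪-comm {S = S} {T = T} = swap S T , swap T S
  where
  swap : ∀ P Q → (P ∪ₙ Q) ⊆ (Q ∪ₙ P)
  swap _ _ (inj₁ Px) = inj₂ Px
  swap _ _ (inj₂ Qx) = inj₁ Qx

shift-∪ : m₁ ≤ m₂ → IsMin B m₂ → ((A ∪ₙ B) ─ m₁) ≐ ((A ─ m₁) ∪ₙ ((B ─ m₂) ⊕ (_≡ m₂ ∸ m₁)))
shift-∪ {m₁ = m₁} {m₂ = m₂} {B = B} {A = A} m₁≤m₂ B-min = split , join
  where
  δ = m₂ ∸ m₁
  y+δ+m₁≡y+m₂ : ∀ y → y + δ + m₁ ≡ y + m₂
  y+δ+m₁≡y+m₂ y = trans (+-assoc y δ m₁) (cong (y +_) (m∸n+n≡m m₁≤m₂))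
  split : ((A ∪ₙ B) ─ m₁) ⊆ ((A ─ m₁) ∪ₙ ((B ─ m₂) ⊕ (_≡ δ)))
  split (inj₁ Ax) = inj₁ Ax
  split (inj₂ Bx) with IsMin-split B-min Bx
  ... | y , By , eq = inj₂ (y , δ , By , refl , +-cancelʳ-≡ m₁ _ _ (trans eq (sym (y+δ+m₁≡y+m₂ y))))
  join : ((A ─ m₁) ∪ₙ ((B ─ m₂) ⊕ (_≡ δ))) ⊆ ((A ∪ₙ B) ─ m₁)
  join (inj₁ Ax) = inj₁ Ax
  join (inj₂ (y , _ , By , refl , refl)) = inj₂ (subst B (sym (y+δ+m₁≡y+m₂ y)) By)

shift-⊕ : IsMin A m₁ → IsMin B m₂ → ((A ⊕ B) ─ (m₁ + m₂)) ≐ ((A ─ m₁) ⊕ (B ─ m₂))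
shift-⊕ {A = A} {m₁ = m₁} {B = B} {m₂ = m₂} A-min B-min = split , join
  where
  split : ((A ⊕ B) ─ (m₁ + m₂)) ⊆ ((A ─ m₁) ⊕ (B ─ m₂))
  split (a , b , Aa , Bb , eq) with IsMin-split A-min Aa | IsMin-split B-min Bb
  ... | y₁ , Ay₁ , refl | y₂ , By₂ , refl =
    y₁ , y₂ , Ay₁ , By₂ , +-cancelʳ-≡ (m₁ + m₂) _ _ (trans eq (interchange y₁ m₁ y₂ m₂))
  join : ((A ─ m₁) ⊕ (B ─ m₂)) ⊆ ((A ⊕ B) ─ (m₁ + m₂))
  join (y₁ , y₂ , Ay₁ , By₂ , refl) = y₁ + m₁ , y₂ + m₂ , Ay₁ , By₂ , interchange y₁ y₂ m₁ m₂

shift-·⋆ : IsMin A m → ∀ n → ((n ·⋆ A) ─ (n * m)) ≐ (n ·⋆ (A ─ m))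
shift-·⋆ _ zero = (λ {x} x+0≡0 → trans (sym (+-identityʳ x)) x+0≡0) , λ { refl → refl }
shift-·⋆ A-min (suc n) = ≐-trans (shift-⊕ A-min (·⋆-min A-min n)) (⊕-congˡ (shift-·⋆ A-min n))

·⋆-∣ : (∀ x → S x → d ∣ x) → ∀ n {x} → (n ·⋆ S) x → d ∣ x
·⋆-∣ {d = d} _ zero refl = d ∣0
·⋆-∣ d∣S (suc n) (s , t , Ss , nSt , refl) = ∣m∣n⇒∣m+n (d∣S s Ss) (·⋆-∣ d∣S n nSt)

·⋆-zero : S 0 → ∀ n → (n ·⋆ S) 0
·⋆-zero _  zero    = refl
·⋆-zero S0 (suc n) = 0 , 0 , S0 , ·⋆-zero S0 n , refl

·⋆-suc-⊇ : S 0 → ∀ n → S ⊆ (suc n ·⋆ S)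
·⋆-suc-⊇ S0 n {x} Sx = x , 0 , Sx , ·⋆-zero S0 n , sym (+-identityʳ x)

y+[a+m]*n≡a*n+y+m*n : ∀ y a m n → y + (a + m) * n ≡ a * n + y + m * n
y+[a+m]*n≡a*n+y+m*n y a m n = trans (cong (y +_) (*-distribʳ-+ n a m)) (x∙yz≈yx∙z y (a * n) (m * n))

⋆-shift-split : IsMin A m₁ → IsMin B m₂ → ((A ⋆ B) ─ (m₁ * m₂)) ⊆
  λ x → Σ ℕ λ y₁ → Σ ℕ λ y → (A ─ m₁) y₁ × ((y₁ + m₁) ·⋆ (B ─ m₂)) y × x ≡ y₁ * m₂ + y
⋆-shift-split {m₁ = m₁} {m₂ = m₂} A-min B-min (a , Aa , x∈aB) with IsMin-split A-min Aa
... | y₁ , Ay₁ , refl with IsMin-split (·⋆-min B-min (y₁ + m₁)) x∈aB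
... | y , y∈ , eq = y₁ , y , Ay₁ , proj₁ (shift-·⋆ B-min (y₁ + m₁)) y∈ ,
  +-cancelʳ-≡ (m₁ * m₂) _ _ (trans eq (y+[a+m]*n≡a*n+y+m*n y y₁ m₁ m₂))

⋆-shift-∈ : IsMin B m₂ → (A ─ m₁) a → ((a + m₁) ·⋆ (B ─ m₂)) ⊆ λ y → ((A ⋆ B) ─ (m₁ * m₂)) (a * m₂ + y)
⋆-shift-∈ {B = B} {m₂ = m₂} {m₁ = m₁} {a = a} B-min Aa {y} y∈ =
  a + m₁ , Aa , subst ((a + m₁) ·⋆ B) (y+[a+m]*n≡a*n+y+m*n y a m₁ m₂) (proj₂ (shift-·⋆ B-min (a + m₁)) y∈)

∪-gcd-≤ : m₁ ≤ m₂ → IsMin B m₂ → IsQ A m₁ q₁ → IsQ B m₂ q₂ →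
  IsQ (A ∪ₙ B) m₁ (gcd q₁ (gcd q₂ (m₂ ∸ m₁)))
∪-gcd-≤ {m₂ = m₂} {B = B} {A = A} m₁≤m₂ B-min A-gcd B-gcd =
  IsGcdSet-resp-≐ (≐-sym (shift-∪ {A = A} m₁≤m₂ B-min))
    (IsGcdSet-∪ A-gcd (IsGcdSet-translate {T = B ─ m₂} (proj₁ B-min) B-gcd))

∪-gcd : IsMin A m₁ → IsMin B m₂ → IsQ A m₁ q₁ → IsQ B m₂ q₂ →
  IsQ (A ∪ₙ B) (m₁ ⊓ m₂) (gcd (gcd q₁ q₂) ∣ m₂ - m₁ ∣)
∪-gcd {A = A} {m₁ = m₁} {B = B} {m₂ = m₂} {q₁ = q₁} {q₂ = q₂} A-min B-min A-gcd B-gcd with ≤-total m₁ m₂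
... | inj₁ m₁≤m₂ rewrite m≤n⇒m⊓n≡m m₁≤m₂ | m≤n⇒∣n-m∣≡n∸m m₁≤m₂ | gcd-assoc q₁ q₂ (m₂ ∸ m₁) =
  ∪-gcd-≤ {A = A} m₁≤m₂ B-min A-gcd B-gcd
... | inj₂ m₂≤m₁ rewrite m≥n⇒m⊓n≡n m₂≤m₁ | m≤n⇒∣m-n∣≡n∸m m₂≤m₁ | gcd-comm q₁ q₂ | gcd-assoc q₂ q₁ (m₁ ∸ m₂) =
  IsGcdSet-resp-≐ (─-cong {S = B ∪ₙ A} ∪-comm) (∪-gcd-≤ {A = B} m₂≤m₁ A-min B-gcd A-gcd)

⊕-gcd : IsMin A m₁ → IsMin B m₂ → IsQ A m₁ q₁ → IsQ B m₂ q₂ → IsQ (A ⊕ B) (m₁ + m₂) (gcd q₁ q₂)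
⊕-gcd {A = A} {m₁ = m₁} {B = B} {m₂ = m₂} A-min B-min A-gcd B-gcd =
  IsGcdSet-resp-≐ (≐-sym (shift-⊕ A-min B-min))
    (IsGcdSet-⊕ {S = A ─ m₁} {T = B ─ m₂} (proj₁ A-min) (proj₁ B-min) A-gcd B-gcd)

IsZeroSet-⋆ : IsZeroSet A → IsZeroSet (A ⋆ B)
IsZeroSet-⋆ {A = A} {B = B} zeroSet x =
  (λ (a , Aa , x∈aB) → subst (λ a → (a ·⋆ B) x) (proj₁ (zeroSet a) Aa) x∈aB) ,
  (λ { refl → 0 , proj₂ (zeroSet 0) refl , refl })

IsZeroSet⇒IsQ : IsZeroSet A → IsQ A m 0
IsZeroSet⇒IsQ zeroSet =
  (λ x A[x+m] → subst (0 ∣_) (sym (m+n≡0⇒m≡0 x (proj₁ (zeroSet _) A[x+m]))) (0 ∣0)) , (λ c _ → c ∣0)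

¬IsZeroSet⇒¬¬∃-suc : ¬ IsZeroSet A → A m → ¬ ¬ ∃ λ k → A (suc k)
¬IsZeroSet⇒¬¬∃-suc {A = A} {m = m} ¬zeroSet Am ∄suc =
  ¬zeroSet λ x → only-zero x , λ { refl → subst A (only-zero m Am) Am }
  where
  only-zero : ∀ x → A x → x ≡ 0
  only-zero zero    _   = refl
  only-zero (suc k) Ask = contradiction (k , Ask) ∄suc

-- A common divisor c of the shifted set divides q₂ once A has a positive element; the
-- hypothesis A ≠ {0} only refutes the absence of one, which suffices as c ∣ q₂ is decidable.
⋆-gcd : IsMin A m₁ → IsMin B m₂ → IsQ A m₁ q₁ → IsQ B m₂ q₂ → ¬ IsZeroSet A →
  IsQ (A ⋆ B) (m₁ * m₂) (gcd q₂ (q₁ * m₂))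
⋆-gcd {A = A} {m₁ = m₁} {B = B} {m₂ = m₂} {q₁ = q₁} {q₂ = q₂}
      A-min B-min A-gcd@(q₁∣A , _) (q₂∣B , greatestᴮ) ¬zeroSet = gcd∣ , greatest
  where
  gcd∣ : ∀ x → ((A ⋆ B) ─ (m₁ * m₂)) x → gcd q₂ (q₁ * m₂) ∣ x
  gcd∣ x x∈ with ⋆-shift-split A-min B-min x∈
  ... | y₁ , y , Ay₁ , y∈ , refl =
    ∣m∣n⇒∣m+n (∣-trans (gcd[m,n]∣n q₂ (q₁ * m₂)) (*-monoˡ-∣ m₂ (q₁∣A y₁ Ay₁)))
              (∣-trans (gcd[m,n]∣m q₂ (q₁ * m₂)) (·⋆-∣ q₂∣B (y₁ + m₁) y∈))
  greatest : ∀ c → (∀ x → ((A ⋆ B) ─ (m₁ * m₂)) x → c ∣ x) → c ∣ gcd q₂ (q₁ * m₂)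
  greatest c c∣ = gcd-greatest c∣q₂ (IsGcdSet-greatest-* A-gcd c∣y₁*m₂)
    where
    c∣y₁*m₂ : ∀ y₁ → (A ─ m₁) y₁ → c ∣ y₁ * m₂
    c∣y₁*m₂ y₁ Ay₁ = subst (c ∣_) (+-identityʳ (y₁ * m₂))
      (c∣ _ (⋆-shift-∈ {A = A} {m₁ = m₁} B-min Ay₁ (·⋆-zero {S = B ─ m₂} (proj₁ B-min) (y₁ + m₁))))
    c∣q₂-from-suc : (∃ λ k → A (suc k)) → c ∣ q₂
    c∣q₂-from-suc (k , Ask) with IsMin-split A-min Ask
    ... | y₁ , Ay₁ , sk≡y₁+m₁ = greatestᴮ c λ y By → ∣m+n∣m⇒∣n
      (c∣ _ (⋆-shift-∈ {A = A} {m₁ = m₁} B-min Ay₁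
        (subst (λ n → (n ·⋆ (B ─ m₂)) y) sk≡y₁+m₁ (·⋆-suc-⊇ {S = B ─ m₂} (proj₁ B-min) k By))))
      (c∣y₁*m₂ y₁ Ay₁)
    c∣q₂ : c ∣ q₂
    c∣q₂ = decidable-stable (c ∣? q₂) λ c∤q₂ →
      ¬IsZeroSet⇒¬¬∃-suc ¬zeroSet (proj₁ A-min) (λ suc∈A → c∤q₂ (c∣q₂-from-suc suc∈A))

proposition2p7 : (A₁ A₂ : SetN) → NonEmpty A₁ → NonEmpty A₂
    → EventuallyPeriodic A₁ → EventuallyPeriodic A₂
    → (m₁ m₂ q₁ q₂ : ℕ)
    → IsMin A₁ m₁ → IsMin A₂ m₂ → IsQ A₁ m₁ q₁ → IsQ A₂ m₂ q₂
    → (IsMin (A₁ ∪ₙ A₂) (m₁ ⊓ m₂)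
        × IsQ (A₁ ∪ₙ A₂) (m₁ ⊓ m₂) (gcd (gcd q₁ q₂) ∣ m₂ - m₁ ∣))
      × (IsMin (A₁ ⊕ A₂) (m₁ + m₂)
        × IsQ (A₁ ⊕ A₂) (m₁ + m₂) (gcd q₁ q₂))
      × (IsMin (A₁ ⋆ A₂) (m₁ * m₂)
        × (IsZeroSet A₁ → IsQ (A₁ ⋆ A₂) (m₁ * m₂) 0)
        × (¬ IsZeroSet A₁ → IsQ (A₁ ⋆ A₂) (m₁ * m₂) (gcd q₂ (q₁ * m₂))))
proposition2p7 A₁ A₂ _ _ _ _ m₁ m₂ q₁ q₂ A₁-min A₂-min A₁-gcd A₂-gcd =
  (∪-min A₁-min A₂-min , ∪-gcd A₁-min A₂-min A₁-gcd A₂-gcd) ,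
  (⊕-min A₁-min A₂-min , ⊕-gcd A₁-min A₂-min A₁-gcd A₂-gcd) ,
  (⋆-min A₁-min A₂-min ,
   (λ zeroSet → IsZeroSet⇒IsQ (IsZeroSet-⋆ zeroSet)) ,
   ⋆-gcd A₁-min A₂-min A₁-gcd A₂-gcd)
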